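{- Let $G$ be a finite graph on $n$ vertices with $\Delta(G)<\frac{1}{9}n-\frac{1}{3}$, and let $k\ge\chi(G)+1$. Let $P\in V(\mathcal{B}_k(G))$ be a reconstruction candidate. Then: (1) $C_P=n$; (2) if $A\in P$ is a part of size $1$ and $B\in P$ is a part of size at most $2$ with $B\neq A$, then there is an edge $uv\in E(G)$ with $u\in A$ and $v\in B$; (3) either $P$ has exactly $k$ parts, or $P$ has no parts of size $2$ or $3$.
   Context: $\chi$ is the chromatic number. An independent set partition of $G$ is a partition of $V(G)$ into nonempty independent sets (parts). For such a partition $P$ and $v\in V(G)$, let $P-v$ be the partition of $V(G)\setminus\{v\}$ obtained by deleting $v$ from its part (discarding that part if empty). The Bell colouring graph $\mathcal{B}(G)$ has as vertices the independent set partitions of $G$, with $P\neq Q$ adjacent iff $P-v=Q-v$ for some $v\in V(G)$; $\mathcal{B}_k(G)$ is its induced subgraph on partitions with at most $k$ parts. For $P\in V(\mathcal{B}_k(G))$, $C_P$ is the number of connected components of the subgraph of $\mathcal{B}_k(G)$ induced on the set of neighbours of $P$; $P$ is a reconstruction candidate if $C_P\ge C_{P'}$ for every $P'\in V(\mathcal{B}_k(G))$. -}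

module Defs where

open import Data.Nat using (ℕ; zero; suc; _+_; _*_; _≤_; _<_; _⊔_)
open import Data.Fin using (Fin)
open import Data.Fin.Base using (toℕ)
open import Data.Bool using (Bool; true; false; if_then_else_; _∧_)
open import Data.Nat.Base using (_<ᵇ_)
open import Data.List using (List; map; foldr; allFin)
open import Data.Nat.ListAction using (sum)
open import Data.Product using (Σ; ∃; _×_; _,_)
open import Data.Empty using (⊥)
open import Relation.Nullary using (¬_)
open import Relation.Binary.PropositionalEquality using (_≡_; _≢_)

record Graph (n : ℕ) : Set where
  field
    adj    : Fin n → Fin n → Bool
    sym    : ∀ x y → adj x y ≡ adj y x
    irrefl : ∀ x → adj x x ≡ false
open Graph public

count : {n : ℕ} → (Fin n → Bool) → ℕ
count {n} f = sum (map (λ x → if f x then 1 else 0) (allFin n))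

degree : {n : ℕ} → Graph n → Fin n → ℕ
degree G v = count (adj G v)

-- maximum degree Δ(G) (0 for the empty graph)
maxDegree : {n : ℕ} → Graph n → ℕ
maxDegree {n} G = foldr _⊔_ 0 (map (degree G) (allFin n))

Colourable : {n : ℕ} → Graph n → ℕ → Set
Colourable {n} G c =
  Σ (Fin n → Fin c) λ f → ∀ x y → adj G x y ≡ true → f x ≢ f y

IsChromaticNumber : {n : ℕ} → Graph n → ℕ → Set
IsChromaticNumber G χ = Colourable G χ × (∀ m → Colourable G m → χ ≤ m)

-- A partition of Fin n is represented by its "same part" relation.
Part : ℕ → Set
Part n = Fin n → Fin n → Bool

_≈P_ : {n : ℕ} → Part n → Part n → Set
P ≈P Q = ∀ x y → P x y ≡ Q x y

IsISPartition : {n : ℕ} → Graph n → Part n → Set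
IsISPartition G P =
  (∀ x → P x x ≡ true) ×
  (∀ x y → P x y ≡ P y x) ×
  (∀ x y z → P x y ≡ true → P y z ≡ true → P x z ≡ true) ×
  (∀ x y → P x y ≡ true → adj G x y ≡ false)

-- number of parts: number of vertices that are the least element of their part
numParts : {n : ℕ} → Part n → ℕ
numParts {n} P = count isLeast
  where
  isLeast : Fin n → Bool
  isLeast x = foldr (λ y b → if P y x ∧ (toℕ y <ᵇ toℕ x) then false else b) true (allFin n)

partSize : {n : ℕ} → Part n → Fin n → ℕ
partSize P a = count (P a)

InBk : {n : ℕ} → Graph n → ℕ → Part n → Set
InBk G k P = IsISPartition G P × numParts P ≤ k

-- adjacency in the Bell colouring graph: P ≠ Q and P - v = Q - v for some v
-- (P - v is the restriction of the same-part relation to V ∖ {v})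
BAdj : {n : ℕ} → Part n → Part n → Set
BAdj {n} P Q = ¬ (P ≈P Q) × ∃ λ (v : Fin n) → ∀ x y → x ≢ v → y ≢ v → P x y ≡ Q x y

InNbhd : {n : ℕ} → Graph n → ℕ → Part n → Part n → Set
InNbhd G k P Q = InBk G k Q × BAdj P Q

data Reach {n : ℕ} (S : Part n → Set) : Part n → Part n → Set where
  here : ∀ {Q Q'} → Q ≈P Q' → Reach S Q Q'
  step : ∀ {Q Q₂ Q'} → S Q₂ → BAdj Q Q₂ → Reach S Q₂ Q' → Reach S Q Q'

-- C_P = c : the subgraph of B_k(G) induced on the neighbours of P has exactly
-- c connected components, witnessed by a labelling of the neighbours by Fin c
-- that is onto and identifies exactly the pairs in the same component.
NumComponents : {n : ℕ} → Graph n → ℕ → Part n → ℕ → Set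
NumComponents {n} G k P c =
  Σ ((Q : Part n) → InNbhd G k P Q → Fin c) λ lab →
    (∀ i → ∃ λ Q → Σ (InNbhd G k P Q) λ q → lab Q q ≡ i) ×
    (∀ Q Q' (q : InNbhd G k P Q) (q' : InNbhd G k P Q') →
       (lab Q q ≡ lab Q' q' → Reach (InNbhd G k P) Q Q') ×
       (Reach (InNbhd G k P) Q Q' → lab Q q ≡ lab Q' q'))

IsReconstructionCandidate : {n : ℕ} → Graph n → ℕ → Part n → ℕ → Set
IsReconstructionCandidate {n} G k P c =
  InBk G k P × NumComponents G k P c ×
  (∀ (P' : Part n) (c' : ℕ) → InBk G k P' → NumComponents G k P' c' → c' ≤ c)

{-# OPTIONS --safe #-}
module Submission where

-- A neighbour Q of P in B_k(G) agrees with P off some vertex v, and two neighbours agreeing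
-- with P off the same v are equal or adjacent. Hence distinct components of the neighbourhood
-- get distinct such vertices, C_P ≤ n, and C_P < n as soon as one component contains
-- neighbours agreeing with P off two different vertices.
-- If every part of P has at least four vertices, a partition agreeing with P off two distinct
-- vertices is P itself, and adjacent neighbours agree with P off the same vertex; so C_P = n
-- when P also leaves room for a new part. Such a P with at most χ parts exists: χ ≤ Δ + 1,
-- and while some colour class has one to three vertices, n > 9Δ + 3 leaves a vertex in a class
-- of at least five vertices with no neighbour in the small class; moving it there lowers the
-- total deficit of the small classes. So a reconstruction candidate has C_P = n.
-- Each configuration excluded by (2) or (3) lets one move vertices between the small parts
-- involved so as to find two different vertices in one component, contradicting C_P = n.

open import Defs hiding (sym)

open import Data.Bool using (Bool; true; false; not; _∧_; if_then_else_)
import Data.Bool.Properties as Bool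
open import Data.Fin using (Fin; zero; suc; toℕ; combine; inject≤; punchOut)
open import Data.Fin.Permutation.Components using (transpose; transpose-inverse)
open import Data.Fin.Properties
  using (toℕ-injective; suc-injective; toℕ-inject≤; combine-injective; injective⇒≤; punchOut-injective;
         any?; all?; ¬∀⟶∃¬)
  renaming (_≟_ to _≟ᶠ_)
open import Data.List using (List; []; _∷_; length; lookup; tabulate; foldr; allFin)
open import Data.List.Membership.Propositional using (_∈_; _∉_)
open import Data.List.Membership.Propositional.Properties using (∈-lookup; ∈-map⁺; ∈-allFin)
open import Data.List.Properties using (map-tabulate)
open import Data.List.Relation.Unary.All as All using (All; []; _∷_)
open import Data.List.Relation.Unary.All.Properties using (¬Any⇒All¬; All¬⇒¬Any)
open import Data.List.Relation.Unary.AllPairs using ([]; _∷_)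
open import Data.List.Relation.Unary.Any as Any using (here; there; index)
open import Data.List.Relation.Unary.Any.Properties using (lookup-index)
open import Data.List.Relation.Unary.Unique.Propositional using (Unique)
open import Data.Nat
  using (ℕ; zero; suc; _+_; _*_; _∸_; _⊔_; _≤_; _<_; _<ᵇ_; _≤?_; _<?_; z≤n; s≤s; s≤s⁻¹)
open import Data.Nat.Induction using (<-rec)
open import Data.Nat.ListAction using (sum)
open import Data.Nat.Properties hiding (suc-injective)
open import Algebra.Properties.CommutativeSemigroup +-commutativeSemigroup using (x∙yz≈y∙xz)
open import Data.Product using (∃; _×_; _,_; proj₁; proj₂)
import Data.Product as Product
open import Data.Sum using (_⊎_; inj₁; inj₂)
import Data.Sum as Sum
open import Data.Vec.Functional using (updateAt)
open import Data.Vec.Functional.Properties using (updateAt-updates; updateAt-minimal)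
open import Function using (_∘_; id; flip; case_of_)
open import Function.Bundles using (mk⇔; Equivalence)
open import Relation.Binary.PropositionalEquality
open import Relation.Nullary using (¬_; Dec; does; yes; no; ¬?; _×-dec_; _→-dec_; contradiction)
open import Relation.Nullary.Decidable using (dec-true; dec-false)

private
  variable
    n m : ℕ

indicator : Bool → ℕ
indicator b = if b then 1 else 0

∣_∣ : (Fin n → Bool) → ℕ
∣_∣ {zero}  p = 0
∣_∣ {suc n} p = indicator (p zero) + ∣ p ∘ suc ∣

count≡∣∣ : (p : Fin n → Bool) → count p ≡ ∣ p ∣
count≡∣∣ p = trans (cong sum (map-tabulate id (indicator ∘ p))) (sum-indicator p)
  where
  sum-indicator : ∀ {n} (p : Fin n → Bool) → sum (tabulate (indicator ∘ p)) ≡ ∣ p ∣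
  sum-indicator {zero}  p = refl
  sum-indicator {suc n} p = cong (indicator (p zero) +_) (sum-indicator (p ∘ suc))

enum : (p : Fin n → Bool) → Fin ∣ p ∣ → Fin n
enum {suc n} p i with p zero
enum {suc n} p zero    | true  = zero
enum {suc n} p (suc i) | true  = suc (enum (p ∘ suc) i)
enum {suc n} p i       | false = suc (enum (p ∘ suc) i)

enum-true : (p : Fin n → Bool) (i : Fin ∣ p ∣) → p (enum p i) ≡ true
enum-true {suc n} p i with p zero in p0
enum-true {suc n} p zero    | true  = p0
enum-true {suc n} p (suc i) | true  = enum-true (p ∘ suc) i
enum-true {suc n} p i       | false = enum-true (p ∘ suc) i

enum-injective : (p : Fin n → Bool) {i j : Fin ∣ p ∣} → enum p i ≡ enum p j → i ≡ j
enum-injective {suc n} p {i} {j} eq with p zero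
enum-injective {suc n} p {zero}  {zero}  eq | true = refl
enum-injective {suc n} p {suc i} {suc j} eq | true =
  cong suc (enum-injective (p ∘ suc) (suc-injective eq))
enum-injective {suc n} p {i} {j} eq | false =
  enum-injective (p ∘ suc) (suc-injective eq)

enum-surjective : (p : Fin n → Bool) {x : Fin n} → p x ≡ true → ∃ λ i → enum p i ≡ x
enum-surjective {suc n} p {x} px with p zero in p0
enum-surjective {suc n} p {zero}  px | true  = zero , refl
enum-surjective {suc n} p {suc x} px | true  =
  let i , eq = enum-surjective (p ∘ suc) px in suc i , cong suc eq
enum-surjective {suc n} p {zero}  px | false = contradiction (trans (sym px) p0) λ ()
enum-surjective {suc n} p {suc x} px | false =
  let i , eq = enum-surjective (p ∘ suc) px in i , cong suc eq

rank : (p : Fin n → Bool) (x : Fin n) → p x ≡ true → Fin ∣ p ∣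
rank p x px = proj₁ (enum-surjective p px)

enum-rank : (p : Fin n → Bool) (x : Fin n) (px : p x ≡ true) → enum p (rank p x px) ≡ x
enum-rank p x px = proj₂ (enum-surjective p px)

rank-injective : (p : Fin n → Bool) {x y : Fin n} (px : p x ≡ true) (py : p y ≡ true) →
                 rank p x px ≡ rank p y py → x ≡ y
rank-injective p {x} {y} px py eq =
  trans (sym (enum-rank p x px)) (trans (cong (enum p) eq) (enum-rank p y py))

∣∣-≤-injection : (p : Fin n → Bool) (f : ∀ x → p x ≡ true → Fin m) →
                 (∀ {x y} px py → f x px ≡ f y py → x ≡ y) → ∣ p ∣ ≤ m
∣∣-≤-injection p f f-inj =
  injective⇒≤ (λ eq → enum-injective p (f-inj (enum-true p _) (enum-true p _) eq))

∣∣-mono-injection : (p : Fin n → Bool) (q : Fin m → Bool) (f : ∀ x → p x ≡ true → Fin m) →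
                    (∀ x px → q (f x px) ≡ true) →
                    (∀ {x y} px py → f x px ≡ f y py → x ≡ y) → ∣ p ∣ ≤ ∣ q ∣
∣∣-mono-injection p q f qf f-inj = ∣∣-≤-injection p (λ x px → rank q (f x px) (qf x px))
  λ px py → f-inj px py ∘ rank-injective q (qf _ px) (qf _ py)

∣∣-true : ∀ n → ∣ (λ (_ : Fin n) → true) ∣ ≡ n
∣∣-true zero    = refl
∣∣-true (suc n) = cong suc (∣∣-true n)

≤-∣∣-injection : (p : Fin n → Bool) (e : Fin m → Fin n) → (∀ i → p (e i) ≡ true) →
                 (∀ {i j} → e i ≡ e j → i ≡ j) → m ≤ ∣ p ∣
≤-∣∣-injection {m = m} p e pe e-inj = subst (_≤ ∣ p ∣) (∣∣-true m)
  (∣∣-mono-injection (λ _ → true) p (λ i _ → e i) (λ i _ → pe i) (λ _ _ → e-inj))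

∣∣-≤-*-fibres : (p : Fin n → Bool) (K : Fin m → Bool) (fibre : Fin m → Fin n → Bool) (b : ℕ)
         (key : ∀ x → p x ≡ true → Fin m) →
         (∀ x px → K (key x px) ≡ true) → (∀ x px → fibre (key x px) x ≡ true) →
         (∀ i → K i ≡ true → ∣ fibre i ∣ ≤ b) → ∣ p ∣ ≤ ∣ K ∣ * b
∣∣-≤-*-fibres p K fibre b key K-key fibre-key fibre-≤ = ∣∣-≤-injection p code code-injective
  where
  code : ∀ x → p x ≡ true → Fin (∣ K ∣ * b)
  code x px = combine (rank K (key x px) (K-key x px))
                      (inject≤ (rank (fibre (key x px)) x (fibre-key x px))
                               (fibre-≤ (key x px) (K-key x px)))
  rank-cong : ∀ {i j x y} (px : fibre i x ≡ true) (py : fibre j y ≡ true) → i ≡ j →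
              toℕ (rank (fibre i) x px) ≡ toℕ (rank (fibre j) y py) → x ≡ y
  rank-cong px py refl eq = rank-injective _ px py (toℕ-injective eq)
  code-injective : ∀ {x y} px py → code x px ≡ code y py → x ≡ y
  code-injective {x} {y} px py eq with combine-injective _ _ _ _ eq
  ... | same-key , same-rank = rank-cong (fibre-key x px) (fibre-key y py) key-eq (begin
    toℕ (rank (fibre (key x px)) x _)                ≡⟨ toℕ-inject≤ _ _ ⟨
    toℕ (inject≤ (rank (fibre (key x px)) x _) _)    ≡⟨ cong toℕ same-rank ⟩
    toℕ (inject≤ (rank (fibre (key y py)) y _) _)    ≡⟨ toℕ-inject≤ _ _ ⟩
    toℕ (rank (fibre (key y py)) y _)                ∎)
    where
    open ≡-Reasoning
    key-eq : key x px ≡ key y py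
    key-eq = rank-injective K (K-key x px) (K-key y py) same-key

∣∣-cong : {p q : Fin n → Bool} → (∀ x → p x ≡ q x) → ∣ p ∣ ≡ ∣ q ∣
∣∣-cong {zero}  p≗q = refl
∣∣-cong {suc n} p≗q = cong₂ _+_ (cong indicator (p≗q zero)) (∣∣-cong (p≗q ∘ suc))

∣∣-witness : (p : Fin n → Bool) {x : Fin n} → p x ≡ true → 1 ≤ ∣ p ∣
∣∣-witness p {x} px = ≤-∣∣-injection p (λ _ → x) (λ _ → px) λ { {zero} {zero} _ → refl }

∣∣-complement : (p : Fin n → Bool) → ∣ p ∣ + ∣ not ∘ p ∣ ≡ n
∣∣-complement {zero}  p = refl
∣∣-complement {suc n} p with p zero
... | true  = cong suc (∣∣-complement (p ∘ suc))
... | false = trans (+-suc _ _) (cong suc (∣∣-complement (p ∘ suc)))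

∣∣-split : (p q : Fin n → Bool) → ∣ p ∣ ≤ ∣ (λ x → p x ∧ not (q x)) ∣ + ∣ q ∣
∣∣-split {zero}  p q = z≤n
∣∣-split {suc n} p q with p zero | q zero
... | true  | true  = ≤-trans (s≤s (∣∣-split (p ∘ suc) (q ∘ suc))) (≤-reflexive (sym (+-suc _ _)))
... | true  | false = s≤s (∣∣-split (p ∘ suc) (q ∘ suc))
... | false | true  = ≤-trans (m≤n⇒m≤1+n (∣∣-split (p ∘ suc) (q ∘ suc))) (≤-reflexive (sym (+-suc _ _)))
... | false | false = ∣∣-split (p ∘ suc) (q ∘ suc)

∣∣-update : (p q : Fin n → Bool) (u : Fin n) → (∀ x → x ≢ u → p x ≡ q x) →
            indicator (q u) + ∣ p ∣ ≡ indicator (p u) + ∣ q ∣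
∣∣-update {suc n} p q zero p≗q = begin
  indicator (q zero) + (indicator (p zero) + ∣ p ∘ suc ∣)
    ≡⟨ x∙yz≈y∙xz (indicator (q zero)) (indicator (p zero)) _ ⟩
  indicator (p zero) + (indicator (q zero) + ∣ p ∘ suc ∣)
    ≡⟨ cong (λ k → indicator (p zero) + (indicator (q zero) + k)) (∣∣-cong (λ x → p≗q (suc x) λ ())) ⟩
  indicator (p zero) + (indicator (q zero) + ∣ q ∘ suc ∣) ∎
  where open ≡-Reasoning
∣∣-update {suc n} p q (suc u) p≗q = begin
  indicator (q (suc u)) + (indicator (p zero) + ∣ p ∘ suc ∣)
    ≡⟨ x∙yz≈y∙xz (indicator (q (suc u))) (indicator (p zero)) _ ⟩
  indicator (p zero) + (indicator (q (suc u)) + ∣ p ∘ suc ∣)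
    ≡⟨ cong₂ _+_ (cong indicator (p≗q zero λ ()))
                 (∣∣-update (p ∘ suc) (q ∘ suc) u (λ x x≢u → p≗q (suc x) (x≢u ∘ suc-injective))) ⟩
  indicator (q zero) + (indicator (p (suc u)) + ∣ q ∘ suc ∣)
    ≡⟨ x∙yz≈y∙xz (indicator (q zero)) (indicator (p (suc u))) _ ⟩
  indicator (p (suc u)) + (indicator (q zero) + ∣ q ∘ suc ∣) ∎
  where open ≡-Reasoning

∣∣-≤-length : (p : Fin n → Bool) (xs : List (Fin n)) → (∀ x → p x ≡ true → x ∈ xs) →
              ∣ p ∣ ≤ length xs
∣∣-≤-length p xs covered = ∣∣-≤-injection p (λ x px → index (covered x px))
  λ {x} {y} px py eq → trans (lookup-index (covered x px))
                             (trans (cong (lookup xs) eq) (sym (lookup-index (covered y py))))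

∃-∉ : (p : Fin n → Bool) (xs : List (Fin n)) → length xs < ∣ p ∣ → ∃ λ y → p y ≡ true × y ∉ xs
∃-∉ p xs len<∣p∣ with any? (λ y → (p y Bool.≟ true) ×-dec ¬? (Any.any? (y ≟ᶠ_) xs))
... | yes found = found
... | no none   = contradiction (∣∣-≤-length p xs covered) (<⇒≱ len<∣p∣)
  where
  covered : ∀ x → p x ≡ true → x ∈ xs
  covered x px with Any.any? (x ≟ᶠ_) xs
  ... | yes x∈xs = x∈xs
  ... | no  x∉xs = contradiction (x , px , x∉xs) none

Unique⇒lookup-injective : {xs : List (Fin n)} → Unique xs → ∀ {i j} → lookup xs i ≡ lookup xs j → i ≡ j
Unique⇒lookup-injective (_ ∷ _)   {zero}  {zero}  _  = refl
Unique⇒lookup-injective (x∉ ∷ _)  {zero}  {suc j} eq = contradiction eq (All.lookup x∉ (∈-lookup j))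
Unique⇒lookup-injective (x∉ ∷ _)  {suc i} {zero}  eq = contradiction (sym eq) (All.lookup x∉ (∈-lookup i))
Unique⇒lookup-injective (_ ∷ xs!) {suc i} {suc j} eq = cong suc (Unique⇒lookup-injective xs! eq)

∣∣≤length⇒∈ : (p : Fin n → Bool) (xs : List (Fin n)) → Unique xs → All (λ x → p x ≡ true) xs →
                 ∣ p ∣ ≤ length xs → ∀ {y} → p y ≡ true → y ∈ xs
∣∣≤length⇒∈ p xs xs! pxs ∣p∣≤ {y} py with Any.any? (y ≟ᶠ_) xs
... | yes y∈xs = y∈xs
... | no  y∉xs = contradiction ∣p∣≤ (<⇒≱ (≤-∣∣-injection p (lookup (y ∷ xs))
        (λ i → All.lookup (py ∷ pxs) (∈-lookup i))
        (Unique⇒lookup-injective (¬Any⇒All¬ xs y∉xs ∷ xs!))))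

degree≤maxDegree : (G : Graph n) (v : Fin n) → ∣ adj G v ∣ ≤ maxDegree G
degree≤maxDegree G v = subst (_≤ maxDegree G) (count≡∣∣ (adj G v))
  (≤-foldr-⊔ (∈-map⁺ (degree G) (∈-allFin v)))
  where
  ≤-foldr-⊔ : ∀ {d ds} → d ∈ ds → d ≤ foldr _⊔_ 0 ds
  ≤-foldr-⊔ {ds = e ∷ ds} (here refl) = m≤m⊔n e _
  ≤-foldr-⊔ {ds = e ∷ ds} (there d∈ds) = ≤-trans (≤-foldr-⊔ d∈ds) (m≤n⊔m e _)

does⇒ : ∀ {A : Set} (a? : Dec A) → does a? ≡ true → A
does⇒ (yes a) _ = a

IsPartition : Part n → Set
IsPartition P = (∀ x → P x x ≡ true) × (∀ x y → P x y ≡ P y x) ×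
                (∀ x y z → P x y ≡ true → P y z ≡ true → P x z ≡ true)

mkISPartition : {G : Graph n} {P : Part n} → IsPartition P →
                (∀ x y → P x y ≡ true → adj G x y ≡ false) → IsISPartition G P
mkISPartition (P-refl , P-sym , P-trans) P-independent = P-refl , P-sym , P-trans , P-independent

AgreeOff : Part n → Part n → Fin n → Set
AgreeOff P Q v = ∀ x y → x ≢ v → y ≢ v → P x y ≡ Q x y

same-row : {Q : Part n} → IsPartition Q → ∀ {a z} b → Q a z ≡ true → Q a b ≡ Q z b
same-row (_ , Q-sym , Q-trans) {a} {z} b Qaz = Bool.⇔→≡ {z = true}
  (mk⇔ (Q-trans z a b (trans (Q-sym z a) Qaz)) (Q-trans a z b Qaz))

≈P-from-row : {P Q : Part n} → IsPartition P → IsPartition Q → ∀ v → AgreeOff P Q v →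
              (∀ b → b ≢ v → P v b ≡ Q v b) → P ≈P Q
≈P-from-row (P-refl , P-sym , _) (Q-refl , Q-sym , _) v agree row x y with x ≟ᶠ v | y ≟ᶠ v
... | yes refl | yes refl = trans (P-refl x) (sym (Q-refl x))
... | yes refl | no  y≢v  = row y y≢v
... | no  x≢v  | yes refl = trans (P-sym x y) (trans (row x x≢v) (Q-sym y x))
... | no  x≢v  | no  y≢v  = agree x y x≢v y≢v

ker : (Fin n → Fin m) → Part n
ker h x y = does (h x ≟ᶠ h y)

module _ (h : Fin n → Fin m) where

  ker-sound : ∀ {x y} → ker h x y ≡ true → h x ≡ h y
  ker-sound = does⇒ (h _ ≟ᶠ h _)

  ker-complete : ∀ {x y} → h x ≡ h y → ker h x y ≡ true
  ker-complete = dec-true (h _ ≟ᶠ h _)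

  ker-false : ∀ {x y} → h x ≢ h y → ker h x y ≡ false
  ker-false = dec-false (h _ ≟ᶠ h _)

  ker-isPartition : IsPartition (ker h)
  ker-isPartition = (λ x → ker-complete refl)
                  , (λ x y → Bool.⇔→≡ {z = true} (mk⇔ (ker-complete ∘ sym ∘ ker-sound)
                                                       (ker-complete ∘ sym ∘ ker-sound)))
                  , λ x y z xy yz → ker-complete (trans (ker-sound xy) (ker-sound yz))

ker-relabel : {h h′ : Fin n → Fin m} (σ : Fin m → Fin m) → (∀ {c d} → σ c ≡ σ d → c ≡ d) →
              ∀ v → (∀ z → z ≢ v → h′ z ≡ σ (h z)) → AgreeOff (ker h) (ker h′) v
ker-relabel {h = h} {h′} σ σ-inj v h′≗σh x y x≢v y≢v = Bool.⇔→≡ {z = true} (mk⇔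
  (λ hxy → ker-complete h′
     (trans (h′≗σh x x≢v) (trans (cong σ (ker-sound h hxy)) (sym (h′≗σh y y≢v)))))
  (λ h′xy → ker-complete h
     (σ-inj (trans (sym (h′≗σh x x≢v)) (trans (ker-sound h′ h′xy) (h′≗σh y y≢v))))))

-- The helper local to Defs.numParts, repeated verbatim so that numParts P is count (isLeast P)
-- by definition.
isLeast : Part n → Fin n → Bool
isLeast {n} P x = foldr (λ y b → if P y x ∧ (toℕ y <ᵇ toℕ x) then false else b) true (allFin n)

numParts≡∣isLeast∣ : (P : Part n) → numParts P ≡ ∣ isLeast P ∣
numParts≡∣isLeast∣ P = count≡∣∣ (isLeast P)

module _ (P : Part n) (x : Fin n) where

  private
    noneEarlier : List (Fin n) → Bool
    noneEarlier = foldr (λ y b → if P y x ∧ (toℕ y <ᵇ toℕ x) then false else b) true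

    noneEarlier-sound : ∀ ys → noneEarlier ys ≡ true →
                        ∀ {y} → y ∈ ys → P y x ≡ true → toℕ x ≤ toℕ y
    noneEarlier-sound (z ∷ ys) eq z∈ pzx with P z x ∧ (toℕ z <ᵇ toℕ x) in earlier
    noneEarlier-sound (z ∷ ys) () z∈ pzx          | true
    noneEarlier-sound (z ∷ ys) eq (here refl) pzx | false = ≮⇒≥ λ z<x →
      contradiction (trans (sym earlier) (cong₂ _∧_ pzx (Equivalence.to Bool.T-≡ (<⇒<ᵇ z<x)))) λ ()
    noneEarlier-sound (z ∷ ys) eq (there z∈ys) pzx | false = noneEarlier-sound ys eq z∈ys pzx

    noneEarlier-complete : ∀ ys → (∀ y → P y x ≡ true → toℕ x ≤ toℕ y) → noneEarlier ys ≡ true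
    noneEarlier-complete []       minimal = refl
    noneEarlier-complete (z ∷ ys) minimal with P z x ∧ (toℕ z <ᵇ toℕ x) in earlier
    ... | false = noneEarlier-complete ys minimal
    ... | true  with pzx , z<x ← Equivalence.to Bool.T-∧ (Equivalence.from Bool.T-≡ earlier) =
      contradiction (minimal z (Equivalence.to Bool.T-≡ pzx)) (<⇒≱ (<ᵇ⇒< _ _ z<x))

  isLeast-minimal : isLeast P x ≡ true → ∀ y → P y x ≡ true → toℕ x ≤ toℕ y
  isLeast-minimal least y = noneEarlier-sound (allFin n) least (∈-allFin y)

  minimal-isLeast : (∀ y → P y x ≡ true → toℕ x ≤ toℕ y) → isLeast P x ≡ true
  minimal-isLeast = noneEarlier-complete (allFin n)

isLeast-unique : (P : Part n) → IsPartition P → ∀ {x y} →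
                 isLeast P x ≡ true → isLeast P y ≡ true → P x y ≡ true → x ≡ y
isLeast-unique P (_ , P-sym , _) {x} {y} x-least y-least pxy = toℕ-injective (≤-antisym
  (isLeast-minimal P x x-least y (trans (P-sym y x) pxy))
  (isLeast-minimal P y y-least x pxy))

numParts-ker : (h : Fin n → Fin m) (used : Fin m → Bool) → (∀ x → used (h x) ≡ true) →
               numParts (ker h) ≤ ∣ used ∣
numParts-ker h used h-used = subst (_≤ ∣ used ∣) (sym (numParts≡∣isLeast∣ (ker h)))
  (∣∣-mono-injection (isLeast (ker h)) used (λ x _ → h x) (λ x _ → h-used x)
    λ x-least y-least hx≡hy → isLeast-unique (ker h) (ker-isPartition h) x-least y-least (ker-complete h hx≡hy))

least : (p : Fin n → Bool) {x : Fin n} → p x ≡ true →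
        ∃ λ y → p y ≡ true × (∀ z → p z ≡ true → toℕ y ≤ toℕ z)
least {suc n} p {x} px with p zero in p0
... | true = zero , p0 , λ _ _ → z≤n
least {suc n} p {zero}  px | false = contradiction (trans (sym px) p0) λ ()
least {suc n} p {suc x} px | false with y , py , y-min ← least (p ∘ suc) px =
  suc y , py , λ where
    zero    pz → contradiction (trans (sym pz) p0) λ ()
    (suc z) pz → s≤s (y-min z pz)

module Canonical (P : Part n) (P-part : IsPartition P) where

  private
    P-refl = proj₁ P-part
    P-sym = proj₁ (proj₂ P-part)
    P-trans = proj₂ (proj₂ P-part)

  rep : Fin n → Fin n
  rep x = proj₁ (least (P x) (P-refl x))

  rep-∈ : ∀ x → P x (rep x) ≡ true
  rep-∈ x = proj₁ (proj₂ (least (P x) (P-refl x)))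

  rep-minimal : ∀ x z → P x z ≡ true → toℕ (rep x) ≤ toℕ z
  rep-minimal x = proj₂ (proj₂ (least (P x) (P-refl x)))

  rep-cong : ∀ {x y} → P x y ≡ true → rep x ≡ rep y
  rep-cong {x} {y} pxy = toℕ-injective (≤-antisym
    (rep-minimal x (rep y) (P-trans x y (rep y) pxy (rep-∈ y)))
    (rep-minimal y (rep x) (P-trans y x (rep x) (trans (P-sym y x) pxy) (rep-∈ x))))

  rep-sound : ∀ {x y} → rep x ≡ rep y → P x y ≡ true
  rep-sound {x} {y} eq = P-trans x (rep y) y (subst (λ r → P x r ≡ true) eq (rep-∈ x))
                                              (trans (P-sym (rep y) y) (rep-∈ y))

  rep-isLeast : ∀ x → isLeast P (rep x) ≡ true
  rep-isLeast x = minimal-isLeast P (rep x) λ y pyr →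
    rep-minimal x y (P-trans x (rep x) y (rep-∈ x) (trans (P-sym (rep x) y) pyr))

  -- Colour suc r names the part with least element r; colour zero is kept for a new part.
  canon : Fin n → Fin (suc n)
  canon = suc ∘ rep

  P≗ker-canon : ∀ x y → P x y ≡ ker canon x y
  P≗ker-canon x y = Bool.⇔→≡ {z = true} (mk⇔
    (ker-complete canon ∘ cong suc ∘ rep-cong)
    (rep-sound ∘ suc-injective ∘ ker-sound canon))

  usedColour : Bool → Fin (suc n) → Bool
  usedColour fresh zero    = fresh
  usedColour fresh (suc c) = isLeast P c

  ∣usedColour∣ : ∀ fresh → ∣ usedColour fresh ∣ ≡ indicator fresh + numParts P
  ∣usedColour∣ fresh = cong (indicator fresh +_) (sym (numParts≡∣isLeast∣ P))

≉P-at : ∀ {Q Q′ : Part n} {b} x y → Q x y ≡ b → Q′ x y ≡ not b → ¬ (Q ≈P Q′)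
≉P-at {b = b} x y Qxy Q′xy Q≈Q′ = Bool.not-¬ refl (trans (sym Qxy) (trans (Q≈Q′ x y) Q′xy))

_≈P?_ : (Q Q′ : Part n) → Dec (Q ≈P Q′)
Q ≈P? Q′ = all? λ x → all? λ y → Q x y Bool.≟ Q′ x y

injective-missing⇒< : (f : Fin m → Fin n) → (∀ {i j} → f i ≡ f j → i ≡ j) →
                      (z : Fin n) → (∀ i → f i ≢ z) → m < n
injective-missing⇒< {n = suc n} f f-inj z missing = s≤s (injective⇒≤ λ {i} {j} eq →
  f-inj (punchOut-injective (missing i ∘ sym) (missing j ∘ sym) eq))

module Neighbours (G : Graph n) (k : ℕ) (P : Part n) where

  witness : ∀ {Q} → InNbhd G k P Q → Fin n
  witness (_ , _ , v , _) = v

  witness-agree : ∀ {Q} (q : InNbhd G k P Q) → AgreeOff P Q (witness q)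
  witness-agree (_ , _ , _ , agree) = agree

  reach-common-witness : ∀ {Q Q′} → InNbhd G k P Q′ → ∀ v → AgreeOff P Q v → AgreeOff P Q′ v →
                         Reach (InNbhd G k P) Q Q′
  reach-common-witness {Q} {Q′} q′ v agree agree′ with Q ≈P? Q′
  ... | yes Q≈Q′ = here Q≈Q′
  ... | no  Q≉Q′ =
    step q′ (Q≉Q′ , v , λ x y x≢v y≢v → trans (sym (agree x y x≢v y≢v)) (agree′ x y x≢v y≢v))
         (here λ _ _ → refl)

module Components (G : Graph n) (k : ℕ) (P : Part n) {c : ℕ} (C : NumComponents G k P c) where

  open Neighbours G k P

  private
    label = proj₁ C
    label-onto = proj₁ (proj₂ C)
    label-reach = proj₂ (proj₂ C)

    Qᵢ : Fin c → Part n
    Qᵢ i = proj₁ (label-onto i)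
    qᵢ : ∀ i → InNbhd G k P (Qᵢ i)
    qᵢ i = proj₁ (proj₂ (label-onto i))
    label-qᵢ : ∀ i → label (Qᵢ i) (qᵢ i) ≡ i
    label-qᵢ i = proj₂ (proj₂ (label-onto i))

    component-witness : Fin c → Fin n
    component-witness i = witness (qᵢ i)

    same-component : ∀ {i j Q Q′} (q : InNbhd G k P Q) (q′ : InNbhd G k P Q′) →
                     AgreeOff P Q (component-witness i) → AgreeOff P Q′ (component-witness j) →
                     Reach (InNbhd G k P) Q Q′ → i ≡ j
    same-component {i} {j} q q′ agree agree′ Q⇝Q′ = begin
      i                      ≡⟨ label-qᵢ i ⟨
      label (Qᵢ i) (qᵢ i)    ≡⟨ proj₂ (label-reach _ _ (qᵢ i) q)
                                       (reach-common-witness q _ (witness-agree (qᵢ i)) agree) ⟩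
      label _ q              ≡⟨ proj₂ (label-reach _ _ q q′) Q⇝Q′ ⟩
      label _ q′             ≡⟨ proj₂ (label-reach _ _ q′ (qᵢ j))
                                       (reach-common-witness (qᵢ j) _ agree′ (witness-agree (qᵢ j))) ⟩
      label (Qᵢ j) (qᵢ j)    ≡⟨ label-qᵢ j ⟩
      j                      ∎
      where open ≡-Reasoning

    component-witness-injective : ∀ {i j} → component-witness i ≡ component-witness j → i ≡ j
    component-witness-injective {i} {j} eq = same-component (qᵢ j) (qᵢ j)
      (subst (AgreeOff P (Qᵢ j)) (sym eq) (witness-agree (qᵢ j))) (witness-agree (qᵢ j)) (here λ _ _ → refl)

  C≤n : c ≤ n
  C≤n = injective⇒≤ component-witness-injective

  C<n : ∀ {u w Q Q′} → u ≢ w → InNbhd G k P Q → InNbhd G k P Q′ →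
        AgreeOff P Q u → AgreeOff P Q′ w → Reach (InNbhd G k P) Q Q′ → c < n
  C<n {u} {w} u≢w q q′ agree agree′ Q⇝Q′ with any? (λ i → component-witness i ≟ᶠ u)
  ... | no u-missing = injective-missing⇒< component-witness component-witness-injective u
                         λ i eq → u-missing (i , eq)
  ... | yes (i , wᵢ≡u) with any? (λ j → component-witness j ≟ᶠ w)
  ...   | no w-missing = injective-missing⇒< component-witness component-witness-injective w
                           λ j eq → w-missing (j , eq)
  ...   | yes (j , wⱼ≡w) = contradiction (begin
          u                     ≡⟨ wᵢ≡u ⟨
          component-witness i   ≡⟨ cong component-witness i≡j ⟩
          component-witness j   ≡⟨ wⱼ≡w ⟩
          w                     ∎) u≢w
    where
    open ≡-Reasoning
    i≡j : i ≡ j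
    i≡j = same-component q q′ (subst (AgreeOff P _) (sym wᵢ≡u) agree)
                              (subst (AgreeOff P _) (sym wⱼ≡w) agree′) Q⇝Q′

module _ {m} (i j : Fin m) where

  transpose-injective : ∀ {c d} → transpose i j c ≡ transpose i j d → c ≡ d
  transpose-injective {c} {d} eq =
    trans (sym (transpose-inverse j i)) (trans (cong (transpose j i) eq) (transpose-inverse j i))

  transpose-ˡ : transpose i j i ≡ j
  transpose-ˡ rewrite dec-true (i ≟ᶠ i) refl = refl

  transpose-ʳ : transpose i j j ≡ i
  transpose-ʳ with j ≟ᶠ i
  ... | yes j≡i = j≡i
  ... | no  _   rewrite dec-true (j ≟ᶠ j) refl = refl

  transpose-fix : ∀ {c} → c ≢ i → c ≢ j → transpose i j c ≡ c
  transpose-fix {c} c≢i c≢j rewrite dec-false (c ≟ᶠ i) c≢i | dec-false (c ≟ᶠ j) c≢j = refl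

module Moves (G : Graph n) (k : ℕ) (P : Part n) (P-IS : IsISPartition G P) (P∈Bk : numParts P ≤ k) where

  P-part : IsPartition P
  P-part = proj₁ P-IS , proj₁ (proj₂ P-IS) , proj₁ (proj₂ (proj₂ P-IS))

  P-independent : ∀ x y → P x y ≡ true → adj G x y ≡ false
  P-independent = proj₂ (proj₂ (proj₂ P-IS))

  open Canonical P P-part public

  canon-same-part : ∀ {a z} → canon z ≡ canon a → P a z ≡ true
  canon-same-part = rep-sound ∘ sym ∘ suc-injective

  agree-relabel : ∀ {h : Fin n → Fin (suc n)} (σ : Fin (suc n) → Fin (suc n)) →
                  (∀ {c d} → σ c ≡ σ d → c ≡ d) → ∀ v → (∀ z → z ≢ v → h z ≡ σ (canon z)) →
                  AgreeOff P (ker h) v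
  agree-relabel σ σ-inj v h≗σcanon x y x≢v y≢v =
    trans (P≗ker-canon x y) (ker-relabel σ σ-inj v h≗σcanon x y x≢v y≢v)

  moveTo : Fin n → Fin (suc n) → Fin n → Fin (suc n)
  moveTo a col = updateAt canon a (λ _ → col)

  isolate : Fin n → Fin n → Fin (suc n)
  isolate a = moveTo a zero

  join : Fin n → Fin n → Fin n → Fin (suc n)
  join a b = moveTo a (canon b)

  moveTo-here : ∀ a col → moveTo a col a ≡ col
  moveTo-here a col = updateAt-updates a canon

  moveTo-elsewhere : ∀ {a z} col → z ≢ a → moveTo a col z ≡ canon z
  moveTo-elsewhere {a} {z} col z≢a = updateAt-minimal z a canon z≢a

  moveTo-apart : ∀ {a z} col → z ≢ a → col ≢ canon z → ker (moveTo a col) a z ≡ false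
  moveTo-apart {a} col z≢a col≢canon-z = ker-false (moveTo a col) λ eq →
    col≢canon-z (trans (sym (moveTo-here a col)) (trans eq (moveTo-elsewhere col z≢a)))

  moveTo-together : ∀ {a z} col → z ≢ a → col ≡ canon z → ker (moveTo a col) a z ≡ true
  moveTo-together {a} col z≢a col≡canon-z = ker-complete (moveTo a col)
    (trans (moveTo-here a col) (trans col≡canon-z (sym (moveTo-elsewhere col z≢a))))

  moveTo-agree : ∀ a col → AgreeOff P (ker (moveTo a col)) a
  moveTo-agree a col = agree-relabel id id a λ z → moveTo-elsewhere col

  moveTo-neighbour : ∀ a col (fresh : Bool) → indicator fresh + numParts P ≤ k →
                     usedColour fresh col ≡ true →
                     (∀ y → y ≢ a → canon y ≡ col → adj G a y ≡ false) →
                     ¬ (P ≈P ker (moveTo a col)) → InNbhd G k P (ker (moveTo a col))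
  moveTo-neighbour a col fresh parts≤k col-used col-free P≉Q =
    (mkISPartition {G = G} (ker-isPartition h) Q-independent ,
     ≤-trans (numParts-ker h (usedColour fresh) h-used) (≤-trans (≤-reflexive (∣usedColour∣ fresh)) parts≤k)) ,
    P≉Q , a , moveTo-agree a col
    where
    h = moveTo a col
    h-used : ∀ x → usedColour fresh (h x) ≡ true
    h-used x with x ≟ᶠ a
    ... | yes refl = subst (λ d → usedColour fresh d ≡ true) (sym (moveTo-here a col)) col-used
    ... | no  x≢a  = subst (λ d → usedColour fresh d ≡ true) (sym (moveTo-elsewhere col x≢a)) (rep-isLeast x)
    Q-independent : ∀ x y → ker h x y ≡ true → adj G x y ≡ false
    Q-independent x y hx≡hy with x ≟ᶠ a | y ≟ᶠ a
    ... | yes refl | yes refl = irrefl G x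
    ... | yes refl | no  y≢a  = col-free y y≢a (trans (sym (moveTo-elsewhere col y≢a))
                                  (trans (sym (ker-sound h hx≡hy)) (moveTo-here a col)))
    ... | no  x≢a  | yes refl = trans (Graph.sym G x y) (col-free x x≢a (trans (sym (moveTo-elsewhere col x≢a))
                                  (trans (ker-sound h hx≡hy) (moveTo-here a col))))
    ... | no  x≢a  | no  y≢a  = P-independent x y (rep-sound (suc-injective (begin
      canon x ≡⟨ moveTo-elsewhere col x≢a ⟨
      h x     ≡⟨ ker-sound h hx≡hy ⟩
      h y     ≡⟨ moveTo-elsewhere col y≢a ⟩
      canon y ∎)))
      where open ≡-Reasoning

  isolate-neighbour : suc (numParts P) ≤ k → ∀ {a a′} → P a a′ ≡ true → a′ ≢ a →
                      InNbhd G k P (ker (isolate a))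
  isolate-neighbour parts<k {a} {a′} Paa′ a′≢a = moveTo-neighbour a zero true parts<k refl (λ _ _ ())
    (≉P-at a a′ Paa′ (moveTo-apart zero a′≢a λ ()))

  join-neighbour : ∀ {a b} → P a b ≡ false → (∀ y → P b y ≡ true → adj G a y ≡ false) →
                   InNbhd G k P (ker (join a b))
  join-neighbour {a} {b} Pab no-edge = moveTo-neighbour a (canon b) false P∈Bk (rep-isLeast b)
    (λ y _ canon-y → no-edge y (canon-same-part canon-y))
    (≉P-at a b Pab (moveTo-together (canon b) b≢a refl))
    where
    b≢a : b ≢ a
    b≢a refl = Bool.not-¬ (proj₁ P-part a) Pab

module Merges (G : Graph n) (k : ℕ) (P : Part n) (P-IS : IsISPartition G P) (P∈Bk : numParts P ≤ k)
              {c : ℕ} (C : NumComponents G k P c) where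

  open Moves G k P P-IS P∈Bk
  open Components G k P C
  open ≡-Reasoning

  private
    P-refl = proj₁ P-part
    P-sym = proj₁ (proj₂ P-part)

    canon-outside : ∀ {a z} (xs : List (Fin n)) → Unique xs → All (λ x → P a x ≡ true) xs →
                    ∣ P a ∣ ≤ length xs → All (z ≢_) xs → canon z ≢ canon a
    canon-outside xs xs! Pa-xs ∣Pa∣≤ z∉xs =
      All¬⇒¬Any z∉xs ∘ ∣∣≤length⇒∈ (P _) xs xs! Pa-xs ∣Pa∣≤ ∘ canon-same-part

  -- In each agreement below, off the given vertex the second colouring is the first followed
  -- by the transposition σ of two colours.
  isolate-agree-off-partner : ∀ {a a′} → ∣ P a ∣ ≤ 2 → P a a′ ≡ true → a ≢ a′ →
                              AgreeOff P (ker (isolate a)) a′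
  isolate-agree-off-partner {a} {a′} size≤2 Paa′ a≢a′ =
    agree-relabel σ (transpose-injective _ _) a′ λ z z≢a′ → case z ≟ᶠ a of λ where
      (yes refl) → begin
        isolate z z  ≡⟨ moveTo-here z zero ⟩
        zero         ≡⟨ transpose-ˡ (canon z) zero ⟨
        σ (canon z)  ∎
      (no z≢a) → begin
        isolate a z  ≡⟨ moveTo-elsewhere zero z≢a ⟩
        canon z      ≡⟨ transpose-fix (canon a) zero
                          (canon-outside (a ∷ a′ ∷ []) ((a≢a′ ∷ []) ∷ [] ∷ []) (P-refl a ∷ Paa′ ∷ [])
                             size≤2 (z≢a ∷ z≢a′ ∷ []))
                          (λ ()) ⟨
        σ (canon z)  ∎
    where
    σ = transpose (canon a) zero

  isolate-agree-isolate : ∀ {a a′ a″} → ∣ P a ∣ ≤ 3 → P a a′ ≡ true → P a a″ ≡ true →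
                          a ≢ a′ → a ≢ a″ → a′ ≢ a″ →
                          AgreeOff (ker (isolate a)) (ker (isolate a′)) a″
  isolate-agree-isolate {a} {a′} {a″} size≤3 Paa′ Paa″ a≢a′ a≢a″ a′≢a″ =
    ker-relabel {h = isolate a} σ (transpose-injective _ _) a″ λ z z≢a″ → case z ≟ᶠ a of λ where
      (yes refl) → begin
        isolate a′ z       ≡⟨ moveTo-elsewhere zero a≢a′ ⟩
        canon z            ≡⟨ transpose-ˡ zero (canon z) ⟨
        σ zero             ≡⟨ cong σ (moveTo-here z zero) ⟨
        σ (isolate z z)    ∎
      (no z≢a) → case z ≟ᶠ a′ of λ where
        (yes refl) → begin
          isolate z z      ≡⟨ moveTo-here z zero ⟩
          zero             ≡⟨ transpose-ʳ zero (canon a) ⟨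
          σ (canon a)      ≡⟨ cong σ (trans (moveTo-elsewhere zero z≢a) (cong suc (sym (rep-cong Paa′)))) ⟨
          σ (isolate a z)  ∎
        (no z≢a′) → begin
          isolate a′ z     ≡⟨ moveTo-elsewhere zero z≢a′ ⟩
          canon z          ≡⟨ transpose-fix zero (canon a) (λ ())
                                (canon-outside (a ∷ a′ ∷ a″ ∷ [])
                                   ((a≢a′ ∷ a≢a″ ∷ []) ∷ (a′≢a″ ∷ []) ∷ [] ∷ [])
                                   (P-refl a ∷ Paa′ ∷ Paa″ ∷ []) size≤3 (z≢a ∷ z≢a′ ∷ z≢a″ ∷ [])) ⟨
          σ (canon z)      ≡⟨ cong σ (moveTo-elsewhere zero z≢a) ⟨
          σ (isolate a z)  ∎
    where
    σ = transpose zero (canon a)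

  join-agree-off-target : ∀ {a b} → ∣ P a ∣ ≤ 1 → ∣ P b ∣ ≤ 1 → AgreeOff P (ker (join a b)) b
  join-agree-off-target {a} {b} size-a size-b =
    agree-relabel σ (transpose-injective _ _) b λ z z≢b → case z ≟ᶠ a of λ where
      (yes refl) → begin
        join z b z   ≡⟨ moveTo-here z (canon b) ⟩
        canon b      ≡⟨ transpose-ˡ (canon z) (canon b) ⟨
        σ (canon z)  ∎
      (no z≢a) → begin
        join a b z   ≡⟨ moveTo-elsewhere (canon b) z≢a ⟩
        canon z      ≡⟨ transpose-fix (canon a) (canon b)
                          (canon-outside (a ∷ []) ([] ∷ []) (P-refl a ∷ []) size-a (z≢a ∷ []))
                          (canon-outside (b ∷ []) ([] ∷ []) (P-refl b ∷ []) size-b (z≢b ∷ [])) ⟨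
        σ (canon z)  ∎
    where
    σ = transpose (canon a) (canon b)

  join-agree-join : ∀ {a b b′} → ∣ P a ∣ ≤ 1 → ∣ P b ∣ ≤ 2 → P b b′ ≡ true → b ≢ b′ →
                    a ≢ b → AgreeOff (ker (join a b)) (ker (join b a)) b′
  join-agree-join {a} {b} {b′} size-a size-b Pbb′ b≢b′ a≢b =
    ker-relabel {h = join a b} σ (transpose-injective _ _) b′ λ z z≢b′ → case z ≟ᶠ a of λ where
      (yes refl) → begin
        join b z z         ≡⟨ moveTo-elsewhere (canon z) a≢b ⟩
        canon z            ≡⟨ transpose-ˡ (canon b) (canon z) ⟨
        σ (canon b)        ≡⟨ cong σ (moveTo-here z (canon b)) ⟨
        σ (join z b z)     ∎
      (no z≢a) → case z ≟ᶠ b of λ where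
        (yes refl) → begin
          join z a z       ≡⟨ moveTo-here z (canon a) ⟩
          canon a          ≡⟨ transpose-ˡ (canon z) (canon a) ⟨
          σ (canon z)      ≡⟨ cong σ (moveTo-elsewhere (canon z) z≢a) ⟨
          σ (join a z z)   ∎
        (no z≢b) → begin
          join b a z       ≡⟨ moveTo-elsewhere (canon a) z≢b ⟩
          canon z          ≡⟨ transpose-fix (canon b) (canon a)
                                (canon-outside (b ∷ b′ ∷ []) ((b≢b′ ∷ []) ∷ [] ∷ [])
                                   (P-refl b ∷ Pbb′ ∷ []) size-b (z≢b ∷ z≢b′ ∷ []))
                                (canon-outside (a ∷ []) ([] ∷ []) (P-refl a ∷ []) size-a (z≢a ∷ [])) ⟨
          σ (canon z)      ≡⟨ cong σ (moveTo-elsewhere (canon b) z≢a) ⟨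
          σ (join a b z)   ∎
    where
    σ = transpose (canon b) (canon a)

  split-pair : suc (numParts P) ≤ k → ∀ a → ∣ P a ∣ ≡ 2 → c < n
  split-pair parts<k a size≡2 with a′ , Paa′ , a′∉ ← ∃-∉ (P a) (a ∷ []) (≤-reflexive (sym size≡2)) =
    C<n a≢a′ Q-nbr Q-nbr (moveTo-agree a zero)
      (isolate-agree-off-partner (≤-reflexive size≡2) Paa′ a≢a′) (here λ _ _ → refl)
    where
    a≢a′ : a ≢ a′
    a≢a′ = a′∉ ∘ here ∘ sym
    Q-nbr = isolate-neighbour parts<k Paa′ (a≢a′ ∘ sym)

  split-triple : suc (numParts P) ≤ k → ∀ a → ∣ P a ∣ ≡ 3 → c < n
  split-triple parts<k a size≡3
    with a′ , Paa′ , a′∉ ← ∃-∉ (P a) (a ∷ []) (<⇒≤ (≤-reflexive (sym size≡3)))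
    with a″ , Paa″ , a″∉ ← ∃-∉ (P a) (a ∷ a′ ∷ []) (≤-reflexive (sym size≡3)) =
    C<n a≢a′ Q₁-nbr Q₂-nbr (moveTo-agree a zero) (moveTo-agree a′ zero)
      (step Q₂-nbr
        (Q₁≉Q₂ , a″ , isolate-agree-isolate (≤-reflexive size≡3) Paa′ Paa″ a≢a′ a≢a″ a′≢a″)
        (here λ _ _ → refl))
    where
    a≢a′ : a ≢ a′
    a≢a′ = a′∉ ∘ here ∘ sym
    a≢a″ : a ≢ a″
    a≢a″ = a″∉ ∘ here ∘ sym
    a′≢a″ : a′ ≢ a″
    a′≢a″ = a″∉ ∘ there ∘ here ∘ sym
    Q₁-nbr = isolate-neighbour parts<k Paa′ (a≢a′ ∘ sym)
    Pa′a″ : P a′ a″ ≡ true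
    Pa′a″ = trans (same-row P-part a″ (trans (P-sym a′ a) Paa′)) Paa″
    Q₂-nbr = isolate-neighbour parts<k Pa′a″ (a′≢a″ ∘ sym)
    Q₁≉Q₂ : ¬ (ker (isolate a) ≈P ker (isolate a′))
    Q₁≉Q₂ = ≉P-at a′ a″
      (ker-complete (isolate a) (begin
        isolate a a′  ≡⟨ moveTo-elsewhere zero (a≢a′ ∘ sym) ⟩
        canon a′      ≡⟨ cong suc (trans (sym (rep-cong Paa′)) (rep-cong Paa″)) ⟩
        canon a″      ≡⟨ moveTo-elsewhere zero (a≢a″ ∘ sym) ⟨
        isolate a a″  ∎))
      (moveTo-apart zero (a′≢a″ ∘ sym) λ ())

  join-singleton : ∀ a b → ∣ P a ∣ ≡ 1 → ∣ P b ∣ ≤ 2 → P a b ≡ false →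
                   (∀ u v → P a u ≡ true → P b v ≡ true → adj G u v ≡ false) → c < n
  join-singleton a b size-a size-b Pab no-edge with ∣ P b ∣ ≤? 1
  ... | yes size-b≤1 = C<n a≢b Q₁-nbr Q₁-nbr (moveTo-agree a (canon b))
                         (join-agree-off-target (≤-reflexive size-a) size-b≤1) (here λ _ _ → refl)
    where
    a≢b : a ≢ b
    a≢b refl = Bool.not-¬ (P-refl a) Pab
    Q₁-nbr = join-neighbour Pab λ y → no-edge a y (P-refl a)
  ... | no size-b≰1 with b′ , Pbb′ , b′∉ ← ∃-∉ (P b) (b ∷ []) (≰⇒> size-b≰1) =
    C<n a≢b Q₁-nbr Q₂-nbr (moveTo-agree a (canon b)) (moveTo-agree b (canon a))
      (step Q₂-nbr (Q₁≉Q₂ , b′ , join-agree-join (≤-reflexive size-a) size-b Pbb′ b≢b′ a≢b)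
            (here λ _ _ → refl))
    where
    a≢b : a ≢ b
    a≢b refl = Bool.not-¬ (P-refl a) Pab
    b≢b′ : b ≢ b′
    b≢b′ = b′∉ ∘ here ∘ sym
    Pba : P b a ≡ false
    Pba = trans (P-sym b a) Pab
    b′≢a : b′ ≢ a
    b′≢a refl = Bool.not-¬ Pbb′ Pba
    canon-b′ : canon b′ ≡ canon b
    canon-b′ = cong suc (sym (rep-cong Pbb′))
    Q₁-nbr = join-neighbour Pab λ y → no-edge a y (P-refl a)
    Q₂-nbr = join-neighbour Pba λ y Pay → trans (Graph.sym G b y) (no-edge y b Pay (P-refl b))
    Q₁≉Q₂ : ¬ (ker (join a b) ≈P ker (join b a))
    Q₁≉Q₂ = ≉P-at b b′
      (ker-complete (join a b) (begin
        join a b b   ≡⟨ moveTo-elsewhere (canon b) (a≢b ∘ sym) ⟩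
        canon b      ≡⟨ canon-b′ ⟨
        canon b′     ≡⟨ moveTo-elsewhere (canon b) b′≢a ⟨
        join a b b′  ∎))
      (moveTo-apart (canon a) (b≢b′ ∘ sym) (Bool.not-¬ Pba ∘ canon-same-part ∘ flip trans canon-b′))

  module _ (C≮n : ¬ c < n) where

    edge-between-small-parts : ∀ a b → ∣ P a ∣ ≡ 1 → ∣ P b ∣ ≤ 2 → P a b ≡ false →
                               ∃ λ u → ∃ λ v → P a u ≡ true × P b v ≡ true × adj G u v ≡ true
    edge-between-small-parts a b size-a size-b Pab
      with any? (λ u → any? λ v → (P a u Bool.≟ true) ×-dec (P b v Bool.≟ true) ×-dec (adj G u v Bool.≟ true))
    ... | yes edge   = edge
    ... | no no-edge = contradiction (join-singleton a b size-a size-b Pab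
                         λ u v Pau Pbv → Bool.¬-not λ uv → no-edge (u , v , Pau , Pbv , uv)) C≮n

    all-parts-used-or-no-part-of-size-2-or-3 : numParts P ≡ k ⊎ (∀ a → ∣ P a ∣ ≢ 2 × ∣ P a ∣ ≢ 3)
    all-parts-used-or-no-part-of-size-2-or-3 with numParts P ≟ k
    ... | yes parts≡k = inj₁ parts≡k
    ... | no  parts≢k = inj₂ λ a →
      C≮n ∘ split-pair (≤∧≢⇒< P∈Bk parts≢k) a , C≮n ∘ split-triple (≤∧≢⇒< P∈Bk parts≢k) a

module LargeParts (G : Graph n) (k : ℕ) (P : Part n) (P-IS : IsISPartition G P)
                  (parts<k : suc (numParts P) ≤ k) (large : ∀ v → 4 ≤ ∣ P v ∣) where

  open Neighbours G k P
  open Moves G k P P-IS (≤-trans (n≤1+n _) parts<k)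

  private
    another : ∀ v w x → ∃ λ y → P v y ≡ true × y ≢ v × y ≢ w × y ≢ x
    another v w x with y , Pvy , y∉ ← ∃-∉ (P v) (v ∷ w ∷ x ∷ []) (large v) =
      y , Pvy , y∉ ∘ here , y∉ ∘ there ∘ here , y∉ ∘ there ∘ there ∘ here

    neighbour-part : ∀ {Q} → InNbhd G k P Q → IsPartition Q
    neighbour-part (((Q-refl , Q-sym , Q-trans , _) , _) , _) = Q-refl , Q-sym , Q-trans

  agree-off-two⇒≈P : ∀ {Q} → IsPartition Q → ∀ {v w} → v ≢ w →
                     AgreeOff P Q v → AgreeOff P Q w → P ≈P Q
  agree-off-two⇒≈P {Q} Q-part {v} {w} v≢w agree-v agree-w
    with y , Pvy , y≢v , y≢w , _ ← another v w w = ≈P-from-row P-part Q-part v agree-v row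
    where
    open ≡-Reasoning
    row : ∀ b → b ≢ v → P v b ≡ Q v b
    row b b≢v with b ≟ᶠ w
    ... | no  b≢w = agree-w v b v≢w b≢w
    ... | yes refl = begin
      P v b ≡⟨ same-row P-part b Pvy ⟩
      P y b ≡⟨ agree-v y b y≢v b≢v ⟩
      Q y b ≡⟨ same-row Q-part b (trans (sym (agree-w v y v≢w y≢w)) Pvy) ⟨
      Q v b ∎

  distinct-witnesses⇒¬adjacent : ∀ {Q Q′} → IsPartition Q → IsPartition Q′ → ∀ {v w x} → v ≢ w →
                                 AgreeOff P Q v → AgreeOff P Q′ w → ¬ (P ≈P Q) → ¬ (P ≈P Q′) →
                                 ¬ AgreeOff Q Q′ x
  distinct-witnesses⇒¬adjacent {Q} {Q′} Q-part Q′-part {v} {w} {x} v≢w agree-v agree-w P≉Q P≉Q′ agree-x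
    with x ≟ᶠ v | x ≟ᶠ w
  ... | yes refl | _ = P≉Q′ (agree-off-two⇒≈P Q′-part v≢w
                         (λ a b a≢v b≢v → trans (agree-v a b a≢v b≢v) (agree-x a b a≢v b≢v)) agree-w)
  ... | no _ | yes refl = P≉Q (agree-off-two⇒≈P Q-part v≢w agree-v
                         (λ a b a≢w b≢w → trans (agree-w a b a≢w b≢w) (sym (agree-x a b a≢w b≢w))))
  ... | no x≢v | no x≢w with y , Pvy , y≢v , y≢w , y≢x ← another v w x =
    P≉Q (≈P-from-row P-part Q-part v agree-v row)
    where
    open ≡-Reasoning
    Qvy : Q v y ≡ true
    Qvy = begin
      Q v y  ≡⟨ agree-x v y (x≢v ∘ sym) y≢x ⟩
      Q′ v y ≡⟨ agree-w v y v≢w y≢w ⟨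
      P v y  ≡⟨ Pvy ⟩
      true   ∎
    row : ∀ b → b ≢ v → P v b ≡ Q v b
    row b b≢v = begin
      P v b ≡⟨ same-row P-part b Pvy ⟩
      P y b ≡⟨ agree-v y b y≢v b≢v ⟩
      Q y b ≡⟨ same-row Q-part b Qvy ⟨
      Q v b ∎

  reach⇒same-witness : ∀ {Q Q′} → Reach (InNbhd G k P) Q Q′ →
                       (q : InNbhd G k P Q) (q′ : InNbhd G k P Q′) → witness q ≡ witness q′
  reach⇒same-witness (here Q≈Q′) q q′ with witness q ≟ᶠ witness q′
  ... | yes same = same
  ... | no  differ = contradiction (agree-off-two⇒≈P (neighbour-part q′) differ
          (λ x y x≢v y≢v → trans (witness-agree q x y x≢v y≢v) (Q≈Q′ x y)) (witness-agree q′))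
          (proj₁ (proj₂ q′))
  reach⇒same-witness (step q₂ (Q≉Q₂ , x , agree-x) Q₂⇝Q′) q q′ with witness q ≟ᶠ witness q₂
  ... | yes same = trans same (reach⇒same-witness Q₂⇝Q′ q₂ q′)
  ... | no  differ = contradiction agree-x (distinct-witnesses⇒¬adjacent (neighbour-part q) (neighbour-part q₂) differ
          (witness-agree q) (witness-agree q₂) (proj₁ (proj₂ q)) (proj₁ (proj₂ q₂)))

  isolated-neighbour : ∀ v → InNbhd G k P (ker (isolate v))
  isolated-neighbour v with y , Pvy , y≢v , _ ← another v v v =
    isolate-neighbour parts<k Pvy y≢v

  C≡n : NumComponents G k P n
  C≡n = (λ _ q → witness q) , (λ v → _ , isolated-neighbour v , refl) , λ Q Q′ q q′ →
    (λ same → reach-common-witness q′ (witness q) (witness-agree q)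
                (subst (AgreeOff P Q′) (sym same) (witness-agree q′))) ,
    (λ Q⇝Q′ → reach⇒same-witness Q⇝Q′ q q′)

Proper : Graph n → (Fin n → Fin m) → Set
Proper G f = ∀ x y → adj G x y ≡ true → f x ≢ f y

module Recolour (G : Graph n) {m} (f : Fin n → Fin (suc m)) (f-proper : Proper G f) where

  Free : Fin n → Fin m → Set
  Free x i = ∀ y → adj G x y ≡ true → f y ≢ suc i

  free? : ∀ x i → Dec (Free x i)
  free? x i = all? λ y → (adj G x y Bool.≟ true) →-dec ¬? (f y ≟ᶠ suc i)

  private
    shift : ∀ x (c : Fin (suc m)) → (c ≡ zero → ∃ (Free x)) → Fin m
    shift x zero    free = proj₁ (free refl)
    shift x (suc i) _    = i

    shift-spec : ∀ x c free → (c ≡ zero × Free x (shift x c free)) ⊎ c ≡ suc (shift x c free)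
    shift-spec x zero    free = inj₁ (refl , proj₂ (free refl))
    shift-spec x (suc i) free = inj₂ refl

  -- Colour zero is an independent set, so its vertices can all move to free colours at once.
  recolour : (∀ x → f x ≡ zero → ∃ (Free x)) → Fin n → Fin m
  recolour free x = shift x (f x) (free x)

  recolour-proper : ∀ free → Proper G (recolour free)
  recolour-proper free x y xy same with shift-spec x (f x) (free x) | shift-spec y (f y) (free y)
  ... | inj₁ (fx≡0 , _)   | inj₁ (fy≡0 , _)   = f-proper x y xy (trans fx≡0 (sym fy≡0))
  ... | inj₁ (_ , x-free) | inj₂ fy≡          = x-free y xy (trans fy≡ (cong suc (sym same)))
  ... | inj₂ fx≡          | inj₁ (_ , y-free) = y-free x (trans (Graph.sym G y x) xy) (trans fx≡ (cong suc same))
  ... | inj₂ fx≡          | inj₂ fy≡          = f-proper x y xy (trans fx≡ (trans (cong suc same) (sym fy≡)))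

  saturated-degree : ∀ x → (∀ i → ¬ Free x i) → m ≤ ∣ adj G x ∣
  saturated-degree x saturated = ≤-∣∣-injection (adj G x) neighbour (proj₁ ∘ proj₂ ∘ found)
    λ {i} {j} eq → suc-injective (trans (sym (proj₂ (proj₂ (found i))))
                                        (trans (cong f eq) (proj₂ (proj₂ (found j)))))
    where
    found : ∀ i → ∃ λ y → adj G x y ≡ true × f y ≡ suc i
    found i with any? (λ y → (adj G x y Bool.≟ true) ×-dec (f y ≟ᶠ suc i))
    ... | yes y-found = y-found
    ... | no  none    = contradiction (λ y xy fy≡ → none (y , xy , fy≡)) (saturated i)
    neighbour : Fin m → Fin n
    neighbour i = proj₁ (found i)


  not-Colourable⇒high-degree : ¬ Colourable G m → ∃ λ x → m ≤ ∣ adj G x ∣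
  not-Colourable⇒high-degree not-colourable
    with all? (λ x → (f x ≟ᶠ zero) →-dec any? (free? x))
  ... | yes free  = contradiction (recolour free , recolour-proper free) not-colourable
  ... | no  ¬free with x , stuck ← ¬∀⟶∃¬ n _ (λ x → (f x ≟ᶠ zero) →-dec any? (free? x)) ¬free =
    x , saturated-degree x λ i free-i → stuck λ _ → i , free-i

χ≤1+Δ : (G : Graph n) {χ : ℕ} → IsChromaticNumber G χ → χ ≤ suc (maxDegree G)
χ≤1+Δ G {zero}  _ = z≤n
χ≤1+Δ G {suc m} ((f , f-proper) , minimal)
  with x , high ← Recolour.not-Colourable⇒high-degree G f f-proper (λ c → 1+n≰n (minimal m c)) =
  s≤s (≤-trans high (degree≤maxDegree G x))

∑ : (Fin m → ℕ) → ℕ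
∑ {zero}  f = 0
∑ {suc m} f = f zero + ∑ (f ∘ suc)

∑-mono-≤ : {f g : Fin m → ℕ} → (∀ i → f i ≤ g i) → ∑ f ≤ ∑ g
∑-mono-≤ {zero}  f≤g = z≤n
∑-mono-≤ {suc m} f≤g = +-mono-≤ (f≤g zero) (∑-mono-≤ (f≤g ∘ suc))

∑-mono-< : {f g : Fin m → ℕ} → (∀ i → f i ≤ g i) → ∀ c → f c < g c → ∑ f < ∑ g
∑-mono-< f≤g zero    fc<gc = +-mono-<-≤ fc<gc (∑-mono-≤ (f≤g ∘ suc))
∑-mono-< f≤g (suc c) fc<gc = +-mono-≤-< (f≤g zero) (∑-mono-< (f≤g ∘ suc) c fc<gc)

-- How many vertices a non-empty class of size s lacks to reach four; empty classes cost nothing.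
deficit : ℕ → ℕ
deficit zero    = 0
deficit (suc s) = 3 ∸ s

deficit-suc-< : ∀ {s} → 1 ≤ s → s ≤ 3 → deficit (suc s) < deficit s
deficit-suc-< {1} _ _ = ≤-refl
deficit-suc-< {2} _ _ = ≤-refl
deficit-suc-< {3} _ _ = ≤-refl
deficit-suc-< {suc (suc (suc (suc _)))} _ (s≤s (s≤s (s≤s ())))

deficit-≥4 : ∀ {s} → 4 ≤ s → deficit s ≡ 0
deficit-≥4 {suc s} (s≤s 3≤s) = m≤n⇒m∸n≡0 3≤s

∧-≡true : ∀ {a b} → a ∧ b ≡ true → a ≡ true × b ≡ true
∧-≡true {true} {true} _ = refl , refl

not-does : ∀ {A : Set} (a? : Dec A) → not (does a?) ≡ true → ¬ A
not-does (no ¬a) _ = ¬a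

module Balance (G : Graph n) {m} (m≤Δ : m ≤ maxDegree G) (n-large : 9 * maxDegree G + 3 < n) where

  private
    Δ = maxDegree G

  class : (Fin n → Fin (suc m)) → Fin (suc m) → Fin n → Bool
  class g c x = does (c ≟ᶠ g x)

  size : (Fin n → Fin (suc m)) → Fin (suc m) → ℕ
  size g c = ∣ class g c ∣

  Φ : (Fin n → Fin (suc m)) → ℕ
  Φ g = ∑ (deficit ∘ size g)

  private
    slack : 3 * Δ + (m * 4 + 3) < n
    slack = begin-strict
      3 * Δ + (m * 4 + 3) ≤⟨ +-monoʳ-≤ (3 * Δ) (+-monoˡ-≤ 3 (*-monoˡ-≤ 4 m≤Δ)) ⟩
      3 * Δ + (Δ * 4 + 3) ≡⟨ cong (λ t → 3 * Δ + (t + 3)) (*-comm Δ 4) ⟩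
      3 * Δ + (4 * Δ + 3) ≡⟨ +-assoc (3 * Δ) (4 * Δ) 3 ⟨
      3 * Δ + 4 * Δ + 3   ≡⟨ cong (_+ 3) (*-distribʳ-+ Δ 3 4) ⟨
      7 * Δ + 3           ≤⟨ +-monoˡ-≤ 3 (*-monoˡ-≤ Δ (m≤m+n 7 2)) ⟩
      9 * Δ + 3           <⟨ n-large ⟩
      n                   ∎
      where open ≤-Reasoning

  module Movable (g : Fin n → Fin (suc m)) (c : Fin (suc m)) (size≤3 : size g c ≤ 3) where

    big : Fin n → Bool
    big x = does (4 <? size g (g x))

    sees-c : Fin n → Bool
    sees-c x = does (any? λ s → (c ≟ᶠ g s) ×-dec (adj G x s Bool.≟ true))

    ∣sees-c∣ : ∣ sees-c ∣ ≤ 3 * Δ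
    ∣sees-c∣ = ≤-trans
      (∣∣-≤-*-fibres sees-c (class g c) (adj G) Δ (λ x sx → proj₁ (seen x sx))
        (λ x sx → dec-true (c ≟ᶠ _) (proj₁ (proj₂ (seen x sx))))
        (λ x sx → trans (Graph.sym G _ x) (proj₂ (proj₂ (seen x sx))))
        (λ s _ → degree≤maxDegree G s))
      (*-monoˡ-≤ Δ size≤3)
      where
      seen : ∀ x → sees-c x ≡ true → ∃ λ s → c ≡ g s × adj G x s ≡ true
      seen x = does⇒ (any? _)

    ∣small-elsewhere∣ : ∣ (λ x → not (big x) ∧ not (class g c x)) ∣ ≤ m * 4
    ∣small-elsewhere∣ = ≤-trans
      (∣∣-≤-*-fibres _ small-colour (class g) 4 (λ x _ → g x)
        (λ x px → let ¬big , ¬c = ∧-≡true px in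
           cong₂ _∧_ (cong not (dec-false (g x ≟ᶠ c) (not-does (c ≟ᶠ g x) ¬c ∘ sym)))
                     (dec-true (size g (g x) ≤? 4) (≮⇒≥ (not-does (4 <? _) ¬big))))
        (λ x _ → dec-true (g x ≟ᶠ g x) refl)
        (λ e small → does⇒ (size g e ≤? 4) (proj₂ (∧-≡true small))))
      (*-monoˡ-≤ 4 ∣small-colour∣≤m)
      where
      small-colour : Fin (suc m) → Bool
      small-colour e = not (does (e ≟ᶠ c)) ∧ does (size g e ≤? 4)
      ∣small-colour∣≤m : ∣ small-colour ∣ ≤ m
      ∣small-colour∣≤m = ∣∣-≤-injection small-colour
        (λ e se → punchOut (c≢ se))
        λ sd se → punchOut-injective (c≢ sd) (c≢ se)
        where
        c≢ : ∀ {e} → small-colour e ≡ true → c ≢ e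
        c≢ {e} se = not-does (e ≟ᶠ c) (proj₁ (∧-≡true se)) ∘ sym

    private
      candidate : Fin n → Bool
      candidate x = big x ∧ not (sees-c x)

      -- Every non-candidate sees class c (at most 3Δ vertices), lies in another class of size
      -- at most four (at most 4m), or lies in c (at most 3).
      n≤ : n ≤ ∣ candidate ∣ + (3 * Δ + (m * 4 + 3))
      n≤ = begin
        n                                       ≡⟨ ∣∣-complement big ⟨
        ∣ big ∣ + ∣ not ∘ big ∣
          ≤⟨ +-mono-≤ (∣∣-split big sees-c) (∣∣-split (not ∘ big) (class g c)) ⟩
        (∣ candidate ∣ + ∣ sees-c ∣) + (∣ (λ x → not (big x) ∧ not (class g c x)) ∣ + size g c)
          ≤⟨ +-mono-≤ (+-monoʳ-≤ ∣ candidate ∣ ∣sees-c∣) (+-mono-≤ ∣small-elsewhere∣ size≤3) ⟩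
        (∣ candidate ∣ + 3 * Δ) + (m * 4 + 3)   ≡⟨ +-assoc ∣ candidate ∣ (3 * Δ) _ ⟩
        ∣ candidate ∣ + (3 * Δ + (m * 4 + 3))   ∎
        where open ≤-Reasoning

    movable-vertex : ∃ λ u → 4 < size g (g u) × (∀ s → c ≡ g s → adj G u s ≡ false)
    movable-vertex with u , u-candidate , _ ← ∃-∉ candidate [] (+-cancelʳ-< _ 0 _ (<-≤-trans slack n≤)) =
      u , does⇒ (4 <? _) (proj₁ (∧-≡true u-candidate)) , λ s c≡gs → Bool.¬-not λ us →
        not-does (any? _) (proj₂ (∧-≡true u-candidate)) (s , c≡gs , us)

  module MoveVertex (g : Fin n → Fin (suc m)) (g-proper : Proper G g)
                    (c : Fin (suc m)) (1≤size : 1 ≤ size g c) (size≤3 : size g c ≤ 3)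
                    (u : Fin n) (u-big : 4 < size g (g u)) (u-free : ∀ s → c ≡ g s → adj G u s ≡ false) where

    private
      gu≢c : g u ≢ c
      gu≢c gu≡c = <⇒≱ u-big (≤-trans (≤-reflexive (cong (size g) gu≡c)) (m≤n⇒m≤1+n size≤3))

    g′ : Fin n → Fin (suc m)
    g′ = updateAt g u (λ _ → c)

    g′-proper : Proper G g′
    g′-proper x y xy with x ≟ᶠ u | y ≟ᶠ u
    ... | yes refl | yes refl = contradiction (trans (sym xy) (irrefl G x)) λ ()
    ... | yes refl | no  y≢u  = λ g′x≡g′y → Bool.not-¬ xy (u-free y
        (trans (sym (updateAt-updates x g)) (trans g′x≡g′y (updateAt-minimal y x g y≢u))))
    ... | no  x≢u  | yes refl = λ g′x≡g′y → Bool.not-¬ (trans (Graph.sym G y x) xy) (u-free x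
        (trans (sym (updateAt-updates y g)) (trans (sym g′x≡g′y) (updateAt-minimal x y g x≢u))))
    ... | no  x≢u  | no  y≢u  = λ g′x≡g′y → g-proper x y xy
        (trans (sym (updateAt-minimal x u g x≢u)) (trans g′x≡g′y (updateAt-minimal y u g y≢u)))

    private
      size-update : ∀ e {b b′} → does (e ≟ᶠ c) ≡ b → does (e ≟ᶠ g u) ≡ b′ →
                    indicator b + size g e ≡ indicator b′ + size g′ e
      size-update e refl refl =
        subst (λ d → indicator (does (e ≟ᶠ d)) + size g e ≡ indicator (does (e ≟ᶠ g u)) + size g′ e)
              (updateAt-updates u g)
              (∣∣-update (class g e) (class g′ e) u λ x x≢u →
                 cong (does ∘ (e ≟ᶠ_)) (sym (updateAt-minimal x u g x≢u)))

      size-c : size g′ c ≡ suc (size g c)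
      size-c = sym (size-update c (dec-true (c ≟ᶠ c) refl) (dec-false (c ≟ᶠ g u) (gu≢c ∘ sym)))

      size-gu : size g (g u) ≡ suc (size g′ (g u))
      size-gu = size-update (g u) (dec-false (g u ≟ᶠ c) gu≢c) (dec-true (g u ≟ᶠ g u) refl)

      size-other : ∀ e → e ≢ c → e ≢ g u → size g e ≡ size g′ e
      size-other e e≢c e≢gu = size-update e (dec-false (e ≟ᶠ c) e≢c) (dec-false (e ≟ᶠ g u) e≢gu)

      deficit-c : deficit (size g′ c) < deficit (size g c)
      deficit-c = subst (λ s → deficit s < deficit (size g c)) (sym size-c) (deficit-suc-< 1≤size size≤3)

      deficit-≤ : ∀ e → deficit (size g′ e) ≤ deficit (size g e)
      deficit-≤ e with e ≟ᶠ c | e ≟ᶠ g u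
      ... | yes refl | _        = <⇒≤ deficit-c
      ... | no _     | yes refl = ≤-trans (≤-reflexive (deficit-≥4 (s≤s⁻¹ (subst (4 <_) size-gu u-big)))) z≤n
      ... | no e≢c   | no e≢gu  = ≤-reflexive (cong deficit (sym (size-other e e≢c e≢gu)))

    Φ-decreases : Φ g′ < Φ g
    Φ-decreases = ∑-mono-< deficit-≤ c deficit-c

  improve : ∀ g → Proper G g → ∀ c → 1 ≤ size g c → size g c ≤ 3 →
            ∃ λ g′ → Proper G g′ × Φ g′ < Φ g
  improve g g-proper c 1≤size size≤3 = g′ , g′-proper , Φ-decreases
    where
    open Movable g c size≤3 using (movable-vertex)
    open MoveVertex g g-proper c 1≤size size≤3 (proj₁ movable-vertex)
                    (proj₁ (proj₂ movable-vertex)) (proj₂ (proj₂ movable-vertex))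

  Balanced : (Fin n → Fin (suc m)) → Set
  Balanced g = ∀ v → 4 ≤ size g (g v)

  balance : ∀ g → Proper G g → ∃ λ g′ → Proper G g′ × Balanced g′
  balance g = <-rec Goal go (Φ g) g refl
    where
    Goal : ℕ → Set
    Goal φ = ∀ g → Φ g ≡ φ → Proper G g → ∃ λ g′ → Proper G g′ × Balanced g′
    go : ∀ φ → (∀ {ψ} → ψ < φ → Goal ψ) → Goal φ
    go _ rec g refl g-proper with any? (λ c → (1 ≤? size g c) ×-dec (size g c ≤? 3))
    ... | yes (c , 1≤size , size≤3) =
      let g′ , g′-proper , Φ-decreases = improve g g-proper c 1≤size size≤3 in
      rec Φ-decreases g′ refl g′-proper
    ... | no no-small = g , g-proper , λ v → ≰⇒> λ size≤3 →
      no-small (g v , ∣∣-witness (class g (g v)) (dec-true (g v ≟ᶠ g v) refl) , size≤3)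

partition-with-large-parts : (G : Graph n) → 9 * maxDegree G + 3 < n → ∀ {χ k} →
                             IsChromaticNumber G χ → suc χ ≤ k →
                             ∃ λ P → IsISPartition G P × suc (numParts P) ≤ k × (∀ v → 4 ≤ ∣ P v ∣)
partition-with-large-parts {zero}  G () _ _
partition-with-large-parts {suc n} G n-large {zero} ((f , _) , _) _ = case f zero of λ ()
partition-with-large-parts {suc n} G n-large {suc m} χ-is@((f , f-proper) , _) χ<k
  with g , g-proper , g-balanced ← Balance.balance G (≤-pred (χ≤1+Δ G χ-is)) n-large f f-proper =
  ker g , mkISPartition {G = G} (ker-isPartition g) independent , ≤-trans (s≤s parts≤χ) χ<k , g-balanced
  where
  independent : ∀ x y → ker g x y ≡ true → adj G x y ≡ false
  independent x y same = Bool.¬-not λ xy → g-proper x y xy (ker-sound g same)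
  parts≤χ : numParts (ker g) ≤ suc m
  parts≤χ = subst (numParts (ker g) ≤_) (∣∣-true (suc m)) (numParts-ker g (λ _ → true) (λ _ → refl))

n≤C : (G : Graph n) → 9 * maxDegree G + 3 < n → ∀ {χ k P c} →
      IsChromaticNumber G χ → suc χ ≤ k → IsReconstructionCandidate G k P c → n ≤ c
n≤C G n-large χ-is χ<k (_ , _ , maximal)
  with P′ , P′-IS , parts<k , large ← partition-with-large-parts G n-large χ-is χ<k =
  maximal P′ _ (P′-IS , ≤-trans (n≤1+n _) parts<k) (LargeParts.C≡n G _ P′ P′-IS parts<k large)

lemma3p2 : (n : ℕ) (G : Graph n) → 9 * maxDegree G + 3 < n →
    (χ k : ℕ) → IsChromaticNumber G χ → suc χ ≤ k →
    (P : Part n) (c : ℕ) → IsReconstructionCandidate G k P c →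
    (c ≡ n) ×
    (∀ (a b : Fin n) → partSize P a ≡ 1 → partSize P b ≤ 2 → P a b ≡ false →
       ∃ λ u → ∃ λ v → P a u ≡ true × P b v ≡ true × adj G u v ≡ true) ×
    (numParts P ≡ k ⊎ (∀ (a : Fin n) → partSize P a ≢ 2 × partSize P a ≢ 3))
lemma3p2 n G n-large χ k χ-is χ<k P c candidate@((P-IS , parts≤k) , C , _) =
  c≡n ,
  (λ a b size-a size-b → edge-between-small-parts C≮n a b
     (size≡ a size-a) (subst (_≤ 2) (count≡∣∣ (P b)) size-b)) ,
  Sum.map₂ (λ no-small a → Product.map (_∘ size≡ a) (_∘ size≡ a) (no-small a))
           (all-parts-used-or-no-part-of-size-2-or-3 C≮n)
  where
  open Components G k P C
  open Merges G k P P-IS parts≤k C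
  c≡n : c ≡ n
  c≡n = ≤-antisym C≤n (n≤C G n-large χ-is χ<k candidate)
  C≮n : ¬ c < n
  C≮n c<n = <⇒≢ c<n c≡n
  size≡ : ∀ a {s} → partSize P a ≡ s → ∣ P a ∣ ≡ s
  size≡ a = trans (sym (count≡∣∣ (P a)))
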